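{- Let $A$ be a field and $HA$ the ring of Hurwitz series over $A$. Let $h_0,h_1\in HA$ and consider the differential equation $\partial^2(y)+h_1\partial(y)+h_0y=0$ in $HA$. Let $y_1\in HA$ be an invertible element of $HA$ which is a solution of this equation, and let $y_2:=y_1\int\big(\exp(-\int h_1)\,y_1^{ -2}\big)$. Then $y_1$ and $y_2$ are linearly independent over $A$, and the general solution of the equation is $$y=y_1\Big(c_1+c_2\int\big(\exp(-\int h_1)\,y_1^{ -2}\big)\Big),\qquad c_1,c_2\in A,$$ i.e. the solutions are exactly the elements of this form.
   Context: $HA$ is the set of sequences $f=(f(0),f(1),\dots)$ with entries in $A$, with componentwise addition and product $(fg)(m)=\sum_{i=0}^m\binom{m}{i}f(i)g(m-i)$; its identity is $1=(1,0,0,\dots)$. The derivation is $\partial(f)=(f(1),f(2),\dots)$ and the integral is $\int f=(0,f(0),f(1),\dots)$. $y_1^{ -2}$ denotes $(y_1^{ -1})^2$. For $h\in HA$ the divided powers are $h^{[0]}=1$ and $h^{[n]}=\int(h^{[n-1]}\partial(h))$ for $n\ge1$. For $h$ with $h(0)=0$, $\exp(h)=\sum_{n\in\mathbb{N}}h^{[n]}$, the sum being taken componentwise (one has $h^{[n]}(i)=0$ for $i<n$, so each component is a finite sum). -}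

module Defs where

open import Level using (Level; _⊔_)
open import Data.Nat as ℕ using (ℕ; zero; suc; _∸_)
open import Data.Nat.Combinatorics using (_C_)
open import Data.Product using (Σ; ∃; _×_)
open import Relation.Nullary using (¬_)
open import Algebra.Bundles using (CommutativeRing)

record IsField {c ℓ : Level} (R : CommutativeRing c ℓ) : Set (c ⊔ ℓ) where
  open CommutativeRing R
  field
    1≉0     : ¬ (1# ≈ 0#)
    inverse : ∀ x → ¬ (x ≈ 0#) → ∃ λ y → x * y ≈ 1#

module Hurwitz {c ℓ : Level} (R : CommutativeRing c ℓ) where
  open CommutativeRing R renaming (Carrier to A)
  open import Algebra.Definitions.RawMonoid +-rawMonoid using () renaming (_×_ to _·ℕ_)

  HA : Set c
  HA = ℕ → A

  _≈H_ : HA → HA → Set ℓ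
  f ≈H g = ∀ n → f n ≈ g n

  sumTo : ℕ → (ℕ → A) → A
  sumTo zero    f = f 0
  sumTo (suc m) f = sumTo m f + f (suc m)

  const : A → HA
  const a zero    = a
  const a (suc n) = 0#

  0H 1H : HA
  0H = const 0#
  1H = const 1#

  _+H_ : HA → HA → HA
  (f +H g) n = f n + g n

  -H_ : HA → HA
  (-H f) n = - (f n)

  _*H_ : HA → HA → HA
  (f *H g) m = sumTo m (λ i → (m C i) ·ℕ (f i * g (m ∸ i)))

  infix 4 _≈H_
  infixl 6 _+H_
  infixl 7 _*H_

  ∂ : HA → HA
  ∂ f n = f (suc n)

  ∫ : HA → HA
  ∫ f zero    = 0#
  ∫ f (suc n) = f n

  dpow : HA → ℕ → HA
  dpow h zero    = 1H
  dpow h (suc n) = ∫ (dpow h n *H ∂ h)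

  -- exp h = Σ_n h^[n], componentwise: (exp h)(i) = Σ_{n=0}^{i} h^[n](i)
  -- (for h(0) = 0 one has h^[n](i) = 0 for i < n)
  exp : HA → HA
  exp h i = sumTo i (λ n → dpow h n i)

  L : HA → HA → HA → HA
  L h₀ h₁ y = ∂ (∂ y) +H h₁ *H ∂ y +H h₀ *H y

-- Every ring law of Hurwitz series, the derivative of exp, and uniqueness for ∂W = W g follow by
-- induction on the index from (fg)(0) = f(0) g(0) and the Leibniz rule ∂(fg) = ∂f g + f ∂g.
-- For the equation: E = exp (-∫ h₁) satisfies ∂E = -h₁ E, and so, by Abel's identity, does the
-- Wronskian W = y₁ ∂y - ∂y₁ y of y₁ with any solution y; hence W = W(0) E. The quotient rule turns
-- this into ∂(y y₁⁻¹) = W(0) E y₁⁻², which integrates to y = y₁ (c₁ + W(0) ∫ (E y₁⁻²)). Conversely,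
-- by reduction of order L(y₁ u) = u L y₁ + y₁ ∂²u + (2 ∂y₁ + h₁ y₁) ∂u, and ∂u = c₂ E y₁⁻² kills
-- the last two terms. Independence is read off the coefficients 0 and 1 of c₁ + c₂ ∫ (E y₁⁻²).
-- Nothing uses that A is a field: the argument works over any commutative ring.
module Submission where

open import Defs
open import Level using (Level)
open import Data.Nat as ℕ using (ℕ; zero; suc; _∸_; z≤n; s≤s)
open import Data.Nat.Properties using (m≤n⇒m≤1+n; ≤-refl; ≤-trans; m≤n⇒m<n∨m≡n; +-∸-assoc; n<1+n)
open import Data.Nat.Combinatorics using (_C_; nCk+nC[k+1]≡[n+1]C[k+1])
open import Data.Nat.Combinatorics.Specification using (k>n⇒nCk≡0)
open import Data.Sum using (inj₁; inj₂)
open import Data.Product using (∃₂; _×_; _,_)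
open import Function.Bundles using (_⇔_; mk⇔)
open import Relation.Binary.PropositionalEquality as ≡ using (_≡_)
open import Algebra.Bundles using (CommutativeRing)
import Algebra.Solver.Ring.NaturalCoefficients.Default as SemiringSolver

module HurwitzProperties {c ℓ : Level} (R : CommutativeRing c ℓ) where
  open CommutativeRing R renaming (Carrier to A)
  open Hurwitz R
  open import Algebra.Definitions.RawMonoid +-rawMonoid using () renaming (_×_ to _·ℕ_)
  open import Algebra.Properties.Monoid.Mult +-monoid using (×-homo-+; ×-homo-1; ×-cong; ×-congʳ)
  open import Algebra.Properties.CommutativeSemigroup +-commutativeSemigroup using (interchange; x∙yz≈y∙xz)
  open import Relation.Binary.Reasoning.Setoid setoid

  cancel-unitʳ : ∀ {u v a} → u * v ≈ 1# → a * v ≈ 0# → a ≈ 0#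
  cancel-unitʳ {u} {v} {a} uv≈1 av≈0 = begin
    a               ≈⟨ sym (*-identityʳ a) ⟩
    a * 1#          ≈⟨ *-congˡ (sym uv≈1) ⟩
    a * (u * v)     ≈⟨ *-congˡ (*-comm u v) ⟩
    a * (v * u)     ≈⟨ sym (*-assoc a v u) ⟩
    a * v * u       ≈⟨ *-congʳ av≈0 ⟩
    0# * u          ≈⟨ zeroˡ u ⟩
    0#              ∎

  sumTo-cong : ∀ m {F G : ℕ → A} → (∀ i → i ℕ.≤ m → F i ≈ G i) → sumTo m F ≈ sumTo m G
  sumTo-cong zero    F≈G = F≈G 0 z≤n
  sumTo-cong (suc m) F≈G = +-cong (sumTo-cong m (λ i i≤m → F≈G i (m≤n⇒m≤1+n i≤m))) (F≈G (suc m) ≤-refl)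

  sumTo-suc : ∀ m (F : ℕ → A) → sumTo (suc m) F ≈ F 0 + sumTo m (λ i → F (suc i))
  sumTo-suc zero    F = refl
  sumTo-suc (suc m) F = trans (+-congʳ (sumTo-suc m F)) (+-assoc _ _ _)

  sumTo-+ : ∀ m (F G : ℕ → A) → sumTo m (λ i → F i + G i) ≈ sumTo m F + sumTo m G
  sumTo-+ zero    F G = refl
  sumTo-+ (suc m) F G = trans (+-congʳ (sumTo-+ m F G)) (interchange _ _ _ _)

  sumTo-support : ∀ {m} N (F : ℕ → A) → m ℕ.≤ N → (∀ n → m ℕ.< n → F n ≈ 0#) → sumTo N F ≈ sumTo m F
  sumTo-support zero    F z≤n   _    = refl
  sumTo-support (suc N) F m≤1+N F≈0 with m≤n⇒m<n∨m≡n m≤1+N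
  ... | inj₂ ≡.refl        = refl
  ... | inj₁ (s≤s m≤N) =
    trans (+-cong (sumTo-support N F m≤N F≈0) (F≈0 (suc N) (s≤s m≤N))) (+-identityʳ _)

  nC0≡1 : ∀ n → n C 0 ≡ 1
  nC0≡1 zero    = ≡.refl
  nC0≡1 (suc n) = ≡.refl

  nC[1+n]·x≈0 : ∀ n x → (n C suc n) ·ℕ x ≈ 0#
  nC[1+n]·x≈0 n x = ×-cong (k>n⇒nCk≡0 (n<1+n n)) refl

  *H-apply-0 : ∀ f g → (f *H g) 0 ≈ f 0 * g 0
  *H-apply-0 f g = ×-homo-1 _

  ∂-*H : ∀ f g → ∂ (f *H g) ≈H ∂ f *H g +H f *H ∂ g
  ∂-*H f g n = begin
      sumTo (suc n) T
    ≈⟨ sumTo-suc n T ⟩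
      T 0 + sumTo n (λ i → T (suc i))
    ≈⟨ +-congˡ (sumTo-cong n (λ i _ → pascal i)) ⟩
      T 0 + sumTo n (λ i → D i + B i)
    ≈⟨ +-congˡ (sumTo-+ n D B) ⟩
      T 0 + ((∂ f *H g) n + sumTo n B)
    ≈⟨ x∙yz≈y∙xz _ _ _ ⟩
      (∂ f *H g) n + (T 0 + sumTo n B)
    ≈⟨ +-congˡ (sym f∂g-reindexed) ⟩
      (∂ f *H g) n + (f *H ∂ g) n ∎
    where
    T D B U : ℕ → A
    T i = (suc n C i) ·ℕ (f i * g (suc n ∸ i))
    D i = (n C i) ·ℕ (f (suc i) * g (n ∸ i))
    B i = (n C suc i) ·ℕ (f (suc i) * g (n ∸ i))
    U i = (n C i) ·ℕ (f i * g (suc (n ∸ i)))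

    pascal : ∀ i → T (suc i) ≈ D i + B i
    pascal i = trans (×-cong (≡.sym (nCk+nC[k+1]≡[n+1]C[k+1] n i)) refl) (×-homo-+ _ (n C i) (n C suc i))

    shifted : ∀ i → i ℕ.≤ n → U (suc i) ≈ B i
    shifted i i≤n with m≤n⇒m<n∨m≡n i≤n
    ... | inj₁ i<n   = ×-congʳ (n C suc i) (*-congˡ (reflexive (≡.cong g (≡.sym (+-∸-assoc 1 i<n)))))
    ... | inj₂ ≡.refl = trans (nC[1+n]·x≈0 n _) (sym (nC[1+n]·x≈0 n _))

    f∂g-reindexed : sumTo n U ≈ T 0 + sumTo n B
    f∂g-reindexed = begin
        sumTo n U
      ≈⟨ sym (trans (+-congˡ (nC[1+n]·x≈0 n _)) (+-identityʳ _)) ⟩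
        sumTo (suc n) U
      ≈⟨ sumTo-suc n U ⟩
        U 0 + sumTo n (λ i → U (suc i))
      ≈⟨ +-cong (×-cong (≡.trans (nC0≡1 n) (≡.sym (nC0≡1 (suc n)))) refl) (sumTo-cong n shifted) ⟩
        T 0 + sumTo n B ∎

  *H-cong-≤ : ∀ n {f f′ g g′} → (∀ j → j ℕ.≤ n → f j ≈ f′ j) → (∀ j → j ℕ.≤ n → g j ≈ g′ j) →
              (f *H g) n ≈ (f′ *H g′) n
  *H-cong-≤ zero {f} {f′} {g} {g′} f≈f′ g≈g′ =
    trans (*H-apply-0 f g) (trans (*-cong (f≈f′ 0 z≤n) (g≈g′ 0 z≤n)) (sym (*H-apply-0 f′ g′)))
  *H-cong-≤ (suc n) {f} {f′} {g} {g′} f≈f′ g≈g′ = begin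
      (f *H g) (suc n)
    ≈⟨ ∂-*H f g n ⟩
      (∂ f *H g) n + (f *H ∂ g) n
    ≈⟨ +-cong (*H-cong-≤ n (λ j j≤n → f≈f′ (suc j) (s≤s j≤n)) (λ j j≤n → g≈g′ j (m≤n⇒m≤1+n j≤n)))
              (*H-cong-≤ n (λ j j≤n → f≈f′ j (m≤n⇒m≤1+n j≤n)) (λ j j≤n → g≈g′ (suc j) (s≤s j≤n))) ⟩
      (∂ f′ *H g′) n + (f′ *H ∂ g′) n
    ≈⟨ sym (∂-*H f′ g′ n) ⟩
      (f′ *H g′) (suc n) ∎

  *H-cong : ∀ {f f′ g g′} → f ≈H f′ → g ≈H g′ → f *H g ≈H f′ *H g′
  *H-cong f≈f′ g≈g′ n = *H-cong-≤ n (λ j _ → f≈f′ j) (λ j _ → g≈g′ j)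

  *H-vanishes : ∀ n {f} g → (∀ j → j ℕ.≤ n → f j ≈ 0#) → (f *H g) n ≈ 0#
  *H-vanishes zero    {f} g f≈0 = trans (*H-apply-0 f g) (trans (*-congʳ (f≈0 0 z≤n)) (zeroˡ _))
  *H-vanishes (suc n) {f} g f≈0 = trans (∂-*H f g n) (trans
    (+-cong (*H-vanishes n g (λ j j≤n → f≈0 (suc j) (s≤s j≤n)))
            (*H-vanishes n (∂ g) (λ j j≤n → f≈0 j (m≤n⇒m≤1+n j≤n))))
    (+-identityˡ 0#))

  *H-comm : ∀ f g → f *H g ≈H g *H f
  *H-comm f g zero    = trans (*H-apply-0 f g) (trans (*-comm _ _) (sym (*H-apply-0 g f)))
  *H-comm f g (suc n) = trans (∂-*H f g n)
    (trans (+-cong (*H-comm (∂ f) g n) (*H-comm f (∂ g) n)) (trans (+-comm _ _) (sym (∂-*H g f n))))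

  *H-distribʳ : ∀ h f g → (f +H g) *H h ≈H f *H h +H g *H h
  *H-distribʳ h f g zero =
    trans (*H-apply-0 (f +H g) h) (trans (distribʳ _ _ _) (sym (+-cong (*H-apply-0 f h) (*H-apply-0 g h))))
  *H-distribʳ h f g (suc n) = trans (∂-*H (f +H g) h n)
    (trans (+-cong (*H-distribʳ h (∂ f) (∂ g) n) (*H-distribʳ (∂ h) f g n))
    (trans (interchange _ _ _ _) (sym (+-cong (∂-*H f h n) (∂-*H g h n)))))

  *H-distribˡ : ∀ f g h → f *H (g +H h) ≈H f *H g +H f *H h
  *H-distribˡ f g h n = trans (*H-comm f (g +H h) n)
    (trans (*H-distribʳ f g h n) (+-cong (*H-comm g f n) (*H-comm h f n)))

  *H-assoc : ∀ f g h → (f *H g) *H h ≈H f *H (g *H h)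
  *H-assoc f g h zero = begin
      ((f *H g) *H h) 0    ≈⟨ trans (*H-apply-0 (f *H g) h) (*-congʳ (*H-apply-0 f g)) ⟩
      f 0 * g 0 * h 0      ≈⟨ *-assoc _ _ _ ⟩
      f 0 * (g 0 * h 0)    ≈⟨ sym (trans (*H-apply-0 f (g *H h)) (*-congˡ (*H-apply-0 g h))) ⟩
      (f *H (g *H h)) 0    ∎
  *H-assoc f g h (suc n) = begin
      ((f *H g) *H h) (suc n)
    ≈⟨ ∂-*H (f *H g) h n ⟩
      (∂ (f *H g) *H h) n + ((f *H g) *H ∂ h) n
    ≈⟨ +-congʳ (trans (*H-cong {g = h} {g′ = h} (∂-*H f g) (λ _ → refl) n)
                      (*H-distribʳ h (∂ f *H g) (f *H ∂ g) n)) ⟩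
      (((∂ f *H g) *H h) n + ((f *H ∂ g) *H h) n) + ((f *H g) *H ∂ h) n
    ≈⟨ +-cong (+-cong (*H-assoc (∂ f) g h n) (*H-assoc f (∂ g) h n)) (*H-assoc f g (∂ h) n) ⟩
      ((∂ f *H (g *H h)) n + (f *H (∂ g *H h)) n) + (f *H (g *H ∂ h)) n
    ≈⟨ +-assoc _ _ _ ⟩
      (∂ f *H (g *H h)) n + ((f *H (∂ g *H h)) n + (f *H (g *H ∂ h)) n)
    ≈⟨ +-congˡ (sym (trans (*H-cong {f} {f} (λ _ → refl) (∂-*H g h) n)
                           (*H-distribˡ f (∂ g *H h) (g *H ∂ h) n))) ⟩
      (∂ f *H (g *H h)) n + (f *H ∂ (g *H h)) n
    ≈⟨ sym (∂-*H f (g *H h) n) ⟩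
      (f *H (g *H h)) (suc n) ∎

  const-*H-apply : ∀ a f n → (const a *H f) n ≈ a * f n
  const-*H-apply a f zero    = *H-apply-0 (const a) f
  const-*H-apply a f (suc n) = trans (∂-*H (const a) f n)
    (trans (+-congʳ (*H-vanishes n f (λ _ _ → refl))) (trans (+-identityˡ _) (const-*H-apply a (∂ f) n)))

  0H-apply : ∀ n → 0H n ≈ 0#
  0H-apply zero    = refl
  0H-apply (suc n) = refl

  HA-commutativeRing : CommutativeRing c ℓ
  HA-commutativeRing = record
    { Carrier = HA ; _≈_ = _≈H_ ; _+_ = _+H_ ; _*_ = _*H_ ; -_ = -H_ ; 0# = 0H ; 1# = 1H
    ; isCommutativeRing = record
      { isRing = record
        { +-isAbelianGroup = record
          { isGroup = record
            { isMonoid = record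
              { isSemigroup = record
                { isMagma = record
                  { isEquivalence = record
                    { refl = λ _ → refl ; sym = λ p n → sym (p n) ; trans = λ p q n → trans (p n) (q n) }
                  ; ∙-cong = λ p q n → +-cong (p n) (q n) }
                ; assoc = λ f g h n → +-assoc (f n) (g n) (h n) }
              ; identity = (λ f n → trans (+-congʳ (0H-apply n)) (+-identityˡ (f n)))
                         , (λ f n → trans (+-congˡ (0H-apply n)) (+-identityʳ (f n))) }
            ; inverse = (λ f n → trans (-‿inverseˡ (f n)) (sym (0H-apply n)))
                      , (λ f n → trans (-‿inverseʳ (f n)) (sym (0H-apply n)))
            ; ⁻¹-cong = λ p n → -‿cong (p n) }
          ; comm = λ f g n → +-comm (f n) (g n) }
        ; *-cong = *H-cong
        ; *-assoc = *H-assoc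
        ; *-identity = (λ f n → trans (const-*H-apply 1# f n) (*-identityˡ (f n)))
                     , (λ f n → trans (*H-comm f 1H n) (trans (const-*H-apply 1# f n) (*-identityˡ (f n))))
        ; distrib = *H-distribˡ , (λ h f g → *H-distribʳ h f g) }
      ; *-comm = *H-comm } }

  ∂-cong : ∀ {f g} → f ≈H g → ∂ f ≈H ∂ g
  ∂-cong f≈g n = f≈g (suc n)

  ∫-cong : ∀ {f g} → f ≈H g → ∫ f ≈H ∫ g
  ∫-cong f≈g zero    = refl
  ∫-cong f≈g (suc n) = f≈g n

  ∂-const : ∀ a → ∂ (const a) ≈H 0H
  ∂-const a n = sym (0H-apply n)

  ∂-const-*H : ∀ a f → ∂ (const a *H f) ≈H const a *H ∂ f
  ∂-const-*H a f n = trans (const-*H-apply a f (suc n)) (sym (const-*H-apply a (∂ f) n))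

  ∫-const-*H : ∀ a f → ∫ (const a *H f) ≈H const a *H ∫ f
  ∫-const-*H a f zero    = sym (trans (const-*H-apply a (∫ f) 0) (zeroʳ a))
  ∫-const-*H a f (suc n) = trans (const-*H-apply a f n) (sym (const-*H-apply a (∫ f) (suc n)))

  const+∫∂ : ∀ f → f ≈H const (f 0) +H ∫ (∂ f)
  const+∫∂ f zero    = sym (+-identityʳ (f 0))
  const+∫∂ f (suc n) = sym (+-identityˡ (f (suc n)))

  const+const-*H-∫-apply-0 : ∀ a b f → (const a +H const b *H ∫ f) 0 ≈ a
  const+const-*H-∫-apply-0 a b f =
    trans (+-congˡ (trans (const-*H-apply b (∫ f) 0) (zeroʳ b))) (+-identityʳ a)

  const+const-*H-∫-apply-1 : ∀ a b f → (const a +H const b *H ∫ f) 1 ≈ b * f 0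
  const+const-*H-∫-apply-1 a b f = trans (+-identityˡ _) (const-*H-apply b (∫ f) 1)

  dpow-vanishes : ∀ h n {j} → j ℕ.< n → dpow h n j ≈ 0#
  dpow-vanishes h (suc n) {zero}  _           = refl
  dpow-vanishes h (suc n) {suc j} (s≤s j<n) =
    *H-vanishes j (∂ h) (λ k k≤j → dpow-vanishes h n (≤-trans (s≤s k≤j) j<n))

  partialExp : HA → ℕ → HA
  partialExp h N j = sumTo N (λ n → dpow h n j)

  partialExp≈exp : ∀ h N j → j ℕ.≤ N → partialExp h N j ≈ exp h j
  partialExp≈exp h N j j≤N = sumTo-support N (λ n → dpow h n j) j≤N (λ n j<n → dpow-vanishes h n j<n)

  partialExp-*H : ∀ h N g i → (partialExp h N *H g) i ≈ sumTo N (λ n → (dpow h n *H g) i)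
  partialExp-*H h zero    g i = refl
  partialExp-*H h (suc N) g i =
    trans (*H-distribʳ g (partialExp h N) (dpow h (suc N)) i) (+-congʳ (partialExp-*H h N g i))

  ∂-exp : ∀ h → ∂ (exp h) ≈H exp h *H ∂ h
  ∂-exp h i = begin
      exp h (suc i)
    ≈⟨ trans (sumTo-suc i (λ n → dpow h n (suc i))) (+-identityˡ _) ⟩
      sumTo i (λ n → (dpow h n *H ∂ h) i)
    ≈⟨ sym (partialExp-*H h i (∂ h) i) ⟩
      (partialExp h i *H ∂ h) i
    ≈⟨ *H-cong-≤ i {g = ∂ h} {g′ = ∂ h} (partialExp≈exp h i) (λ _ _ → refl) ⟩
      (exp h *H ∂ h) i ∎

  -- Coefficient n + 1 of a solution of ∂W = W g is determined by its coefficients up to n.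
  ∂≈*H-unique : ∀ g {W V} → ∂ W ≈H W *H g → ∂ V ≈H V *H g → W 0 ≈ V 0 → W ≈H V
  ∂≈*H-unique g {W} {V} ∂W ∂V W₀≈V₀ n = agree n n ≤-refl
    where
    agree : ∀ n j → j ℕ.≤ n → W j ≈ V j
    agree zero    .0 z≤n    = W₀≈V₀
    agree (suc n) j  j≤1+n with m≤n⇒m<n∨m≡n j≤1+n
    ... | inj₁ (s≤s j≤n) = agree n j j≤n
    ... | inj₂ ≡.refl     =
      trans (∂W n) (trans (*H-cong-≤ n {g = g} {g′ = g} (agree n) (λ _ _ → refl)) (sym (∂V n)))

module SecondOrder {c ℓ : Level} (R : CommutativeRing c ℓ) (h₀ h₁ : Hurwitz.HA R) where
  open CommutativeRing R renaming (Carrier to A)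
  open Hurwitz R
  open HurwitzProperties R
  module HA = CommutativeRing HA-commutativeRing
  open import Relation.Binary.Reasoning.Setoid HA.setoid
  open SemiringSolver HA.commutativeSemiring using (solve; _:+_; _:*_; _:=_)

  +-vanishingʳ : ∀ {X Z} → Z ≈H 0H → X +H Z ≈H X
  +-vanishingʳ {X} Z≈0 = HA.trans (HA.+-congˡ Z≈0) (HA.+-identityʳ X)

  +-vanishing : ∀ {X Y} → X ≈H 0H → Y ≈H 0H → X +H Y ≈H 0H
  +-vanishing X≈0 Y≈0 = HA.trans (HA.+-congʳ X≈0) (+-vanishingʳ Y≈0)

  *-vanishingʳ : ∀ {K X} → X ≈H 0H → K *H X ≈H 0H
  *-vanishingʳ {K} X≈0 = HA.trans (HA.*-congˡ X≈0) (HA.zeroʳ K)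

  *-vanishingˡ : ∀ K {X} → X ≈H 0H → X *H K ≈H 0H
  *-vanishingˡ K X≈0 = HA.trans (HA.*-congʳ {K} X≈0) (HA.zeroˡ K)

  L-cong : ∀ {y y′} → y ≈H y′ → L h₀ h₁ y ≈H L h₀ h₁ y′
  L-cong y≈y′ = HA.+-cong (HA.+-cong (∂-cong (∂-cong y≈y′)) (HA.*-congˡ (∂-cong y≈y′))) (HA.*-congˡ y≈y′)

  ∂-*H-inverse : ∀ f z → f *H z ≈H 1H → ∂ f *H z +H f *H ∂ z ≈H 0H
  ∂-*H-inverse f z fz≈1 n = trans (sym (∂-*H f z n)) (trans (fz≈1 (suc n)) (sym (0H-apply n)))

  wronskian : HA → HA → HA
  wronskian f g = f *H ∂ g +H -H (∂ f *H g)

  -- HA has no decidable equality to cancel x - x in a ring normal form, so the identities below are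
  -- proved by the semiring solver: each -H X is an atom, and the relation -H X +H X ≈ 0 is added
  -- to the side where it is needed.
  abel : ∀ f g → L h₀ h₁ f ≈H 0H → L h₀ h₁ g ≈H 0H → ∂ (wronskian f g) ≈H wronskian f g *H (-H h₁)
  abel f g Lf≈0 Lg≈0 = begin
      ∂ (wronskian f g)
    ≈⟨ HA.+-congʳ (∂-*H f (∂ g)) ⟩
      ∂ f *H ∂ g +H f *H ∂ (∂ g) +H ∂ m
    ≈⟨ HA.sym (+-vanishingʳ (+-vanishing (+-vanishing (*-vanishingʳ Lf≈0) (*-vanishingʳ k+h₁≈0))
                                         (*-vanishingˡ k (HA.-‿inverseˡ (∂ f *H g))))) ⟩
      ∂ f *H ∂ g +H f *H ∂ (∂ g) +H ∂ m
        +H (g *H L h₀ h₁ f +H f *H ∂ g *H (k +H h₁) +H (m +H ∂ f *H g) *H k)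
    ≈⟨ solve 11 (λ f f′ f″ g g′ g″ h₀ h₁ k m m′ →
         f′ :* g′ :+ f :* g″ :+ m′ :+ (g :* (f″ :+ h₁ :* f′ :+ h₀ :* f) :+ f :* g′ :* (k :+ h₁)
                                        :+ (m :+ f′ :* g) :* k)
         := (f :* g′ :+ m) :* k :+ (f :* (g″ :+ h₁ :* g′ :+ h₀ :* g) :+ (m′ :+ (f″ :* g :+ f′ :* g′))
                                      :+ f′ :* g :* (k :+ h₁)))
         HA.refl f (∂ f) (∂ (∂ f)) g (∂ g) (∂ (∂ g)) h₀ h₁ k m (∂ m) ⟩
      wronskian f g *H k
        +H (f *H L h₀ h₁ g +H (∂ m +H (∂ (∂ f) *H g +H ∂ f *H ∂ g)) +H ∂ f *H g *H (k +H h₁))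
    ≈⟨ +-vanishingʳ (+-vanishing (+-vanishing (*-vanishingʳ Lg≈0) ∂m+∂[∂f·g]≈0) (*-vanishingʳ k+h₁≈0)) ⟩
      wronskian f g *H k ∎
    where
    m k : HA
    m = -H (∂ f *H g)
    k = -H h₁
    k+h₁≈0 : k +H h₁ ≈H 0H
    k+h₁≈0 = HA.-‿inverseˡ h₁
    ∂m+∂[∂f·g]≈0 : ∂ m +H (∂ (∂ f) *H g +H ∂ f *H ∂ g) ≈H 0H
    ∂m+∂[∂f·g]≈0 = HA.trans (HA.+-congˡ (HA.sym (∂-*H (∂ f) g))) (HA.-‿inverseˡ _)

  ∂-quotient : ∀ f z g → f *H z ≈H 1H → ∂ (g *H z) ≈H wronskian f g *H (z *H z)
  ∂-quotient f z g fz≈1 = begin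
      ∂ (g *H z)
    ≈⟨ ∂-*H g z ⟩
      ∂ g *H z +H g *H ∂ z
    ≈⟨ HA.trans (HA.sym (HA.*-identityʳ _)) (HA.*-congˡ (HA.sym fz≈1)) ⟩
      (∂ g *H z +H g *H ∂ z) *H (f *H z)
    ≈⟨ HA.sym (+-vanishingʳ (*-vanishingʳ (HA.-‿inverseˡ (∂ f *H g)))) ⟩
      (∂ g *H z +H g *H ∂ z) *H (f *H z) +H z *H z *H (-H (∂ f *H g) +H ∂ f *H g)
    ≈⟨ solve 7 (λ f f′ g g′ z z′ m →
         (g′ :* z :+ g :* z′) :* (f :* z) :+ z :* z :* (m :+ f′ :* g)
         := (f :* g′ :+ m) :* (z :* z) :+ g :* z :* (f′ :* z :+ f :* z′))
         HA.refl f (∂ f) g (∂ g) z (∂ z) (-H (∂ f *H g)) ⟩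
      wronskian f g *H (z *H z) +H g *H z *H (∂ f *H z +H f *H ∂ z)
    ≈⟨ +-vanishingʳ (*-vanishingʳ (∂-*H-inverse f z fz≈1)) ⟩
      wronskian f g *H (z *H z) ∎

  L-*H : ∀ f u → L h₀ h₁ (f *H u) ≈H u *H L h₀ h₁ f +H (f *H ∂ (∂ u) +H (∂ f +H ∂ f +H h₁ *H f) *H ∂ u)
  L-*H f u = begin
      L h₀ h₁ (f *H u)
    ≈⟨ HA.+-cong (HA.+-cong ∂²[fu] (HA.*-congˡ (∂-*H f u))) HA.refl ⟩
      ∂ (∂ f) *H u +H ∂ f *H ∂ u +H (∂ f *H ∂ u +H f *H ∂ (∂ u))
        +H h₁ *H (∂ f *H u +H f *H ∂ u) +H h₀ *H (f *H u)
    ≈⟨ solve 8 (λ f f′ f″ u u′ u″ h₀ h₁ →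
         f″ :* u :+ f′ :* u′ :+ (f′ :* u′ :+ f :* u″) :+ h₁ :* (f′ :* u :+ f :* u′) :+ h₀ :* (f :* u)
         := u :* (f″ :+ h₁ :* f′ :+ h₀ :* f) :+ (f :* u″ :+ (f′ :+ f′ :+ h₁ :* f) :* u′))
         HA.refl f (∂ f) (∂ (∂ f)) u (∂ u) (∂ (∂ u)) h₀ h₁ ⟩
      u *H L h₀ h₁ f +H (f *H ∂ (∂ u) +H (∂ f +H ∂ f +H h₁ *H f) *H ∂ u) ∎
    where
    ∂²[fu] : ∂ (∂ (f *H u)) ≈H ∂ (∂ f) *H u +H ∂ f *H ∂ u +H (∂ f *H ∂ u +H f *H ∂ (∂ u))
    ∂²[fu] = HA.trans (∂-cong (∂-*H f u)) (HA.+-cong (∂-*H (∂ f) u) (∂-*H f (∂ u)))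

  module SolutionSpace (y₁ z : HA) (y₁z≈1 : y₁ *H z ≈H 1H) (Ly₁≈0 : L h₀ h₁ y₁ ≈H 0H) where
    E P w : HA
    E = exp (-H (∫ h₁))
    P = E *H (z *H z)
    w = ∫ P

    ∂E : ∂ E ≈H E *H (-H h₁)
    ∂E = ∂-exp (-H (∫ h₁))

    P-solves-reduced : y₁ *H ∂ P +H (∂ y₁ +H ∂ y₁ +H h₁ *H y₁) *H P ≈H 0H
    P-solves-reduced = begin
        y₁ *H ∂ P +H (∂ y₁ +H ∂ y₁ +H h₁ *H y₁) *H P
      ≈⟨ HA.+-congʳ (HA.*-congˡ ∂P) ⟩
        y₁ *H (E *H -H h₁ *H (z *H z) +H E *H (∂ z *H z +H z *H ∂ z)) +H (∂ y₁ +H ∂ y₁ +H h₁ *H y₁) *H P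
      ≈⟨ solve 7 (λ E′ y y′ h₁ k z z′ →
           y :* (E′ :* k :* (z :* z) :+ E′ :* (z′ :* z :+ z :* z′))
             :+ (y′ :+ y′ :+ h₁ :* y) :* (E′ :* (z :* z))
           := E′ :* y :* z :* z :* (k :+ h₁) :+ (E′ :* z :+ E′ :* z) :* (y′ :* z :+ y :* z′))
           HA.refl E y₁ (∂ y₁) h₁ (-H h₁) z (∂ z) ⟩
        E *H y₁ *H z *H z *H (-H h₁ +H h₁) +H (E *H z +H E *H z) *H (∂ y₁ *H z +H y₁ *H ∂ z)
      ≈⟨ +-vanishing (*-vanishingʳ (HA.-‿inverseˡ h₁)) (*-vanishingʳ (∂-*H-inverse y₁ z y₁z≈1)) ⟩
        0H ∎
      where
      ∂P : ∂ P ≈H E *H -H h₁ *H (z *H z) +H E *H (∂ z *H z +H z *H ∂ z)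
      ∂P = HA.trans (∂-*H E (z *H z)) (HA.+-cong (HA.*-congʳ {z *H z} ∂E) (HA.*-congˡ (∂-*H z z)))

    y₁[c₁+c₂w]-solves : ∀ c₁ c₂ → L h₀ h₁ (y₁ *H (const c₁ +H const c₂ *H w)) ≈H 0H
    y₁[c₁+c₂w]-solves c₁ c₂ = begin
        L h₀ h₁ (y₁ *H u)
      ≈⟨ L-*H y₁ u ⟩
        u *H L h₀ h₁ y₁ +H (y₁ *H ∂ (∂ u) +H K *H ∂ u)
      ≈⟨ HA.trans (HA.+-congʳ (*-vanishingʳ Ly₁≈0)) (HA.+-identityˡ _) ⟩
        y₁ *H ∂ (∂ u) +H K *H ∂ u
      ≈⟨ HA.+-cong (HA.*-congˡ (HA.trans (∂-cong ∂u) (∂-const-*H c₂ P))) (HA.*-congˡ ∂u) ⟩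
        y₁ *H (const c₂ *H ∂ P) +H K *H (const c₂ *H P)
      ≈⟨ solve 5 (λ y k c p p′ → y :* (c :* p′) :+ k :* (c :* p) := c :* (y :* p′ :+ k :* p))
           HA.refl y₁ K (const c₂) P (∂ P) ⟩
        const c₂ *H (y₁ *H ∂ P +H K *H P)
      ≈⟨ *-vanishingʳ P-solves-reduced ⟩
        0H ∎
      where
      u K : HA
      u = const c₁ +H const c₂ *H w
      K = ∂ y₁ +H ∂ y₁ +H h₁ *H y₁
      ∂u : ∂ u ≈H const c₂ *H P
      ∂u = HA.trans (HA.+-congʳ (∂-const c₁)) (HA.trans (HA.+-identityˡ _) (∂-const-*H c₂ w))

    solution⇒y₁[c₁+c₂w] : ∀ y → L h₀ h₁ y ≈H 0H → ∃₂ λ c₁ c₂ → y ≈H y₁ *H (const c₁ +H const c₂ *H w)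
    solution⇒y₁[c₁+c₂w] y Ly≈0 = (y *H z) 0 , a , (begin
        y
      ≈⟨ HA.trans (HA.sym (HA.*-identityʳ y)) (HA.*-congˡ (HA.sym y₁z≈1)) ⟩
        y *H (y₁ *H z)
      ≈⟨ solve 3 (λ y y₁ z → y :* (y₁ :* z) := y₁ :* (y :* z)) HA.refl y y₁ z ⟩
        y₁ *H (y *H z)
      ≈⟨ HA.*-congˡ yz≈ ⟩
        y₁ *H (const ((y *H z) 0) +H const a *H w) ∎)
      where
      W : HA
      W = wronskian y₁ y
      a : A
      a = W 0
      -- Abel: W and a E solve the same equation ∂V = V (-h₁) and agree at 0, since E(0) = 1.
      W≈aE : W ≈H const a *H E
      W≈aE = ∂≈*H-unique (-H h₁) (abel y₁ y Ly₁≈0 Ly≈0)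
        (HA.trans (∂-const-*H a E) (HA.trans (HA.*-congˡ ∂E) (HA.sym (HA.*-assoc (const a) E (-H h₁)))))
        (sym (trans (const-*H-apply a E 0) (*-identityʳ a)))
      ∂[yz] : ∂ (y *H z) ≈H const a *H P
      ∂[yz] = HA.trans (∂-quotient y₁ z y y₁z≈1)
                       (HA.trans (HA.*-congʳ {z *H z} W≈aE) (HA.*-assoc (const a) E (z *H z)))
      yz≈ : y *H z ≈H const ((y *H z) 0) +H const a *H w
      yz≈ = HA.trans (const+∫∂ (y *H z)) (HA.+-congˡ (HA.trans (∫-cong ∂[yz]) (∫-const-*H a P)))

    independent : ∀ c₁ c₂ → const c₁ *H y₁ +H const c₂ *H (y₁ *H w) ≈H 0H → c₁ ≈ 0# × c₂ ≈ 0#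
    independent c₁ c₂ dependent = c₁≈0 , c₂≈0
      where
      u : HA
      u = const c₁ +H const c₂ *H w
      u≈0 : u ≈H 0H
      u≈0 = begin
          u
        ≈⟨ HA.trans (HA.sym (HA.*-identityʳ u)) (HA.*-congˡ (HA.sym y₁z≈1)) ⟩
          u *H (y₁ *H z)
        ≈⟨ solve 5 (λ c₁ c₂ w y₁ z → (c₁ :+ c₂ :* w) :* (y₁ :* z) := (c₁ :* y₁ :+ c₂ :* (y₁ :* w)) :* z)
             HA.refl (const c₁) (const c₂) w y₁ z ⟩
          (const c₁ *H y₁ +H const c₂ *H (y₁ *H w)) *H z
        ≈⟨ *-vanishingˡ z dependent ⟩
          0H ∎
      c₁≈0 : c₁ ≈ 0#
      c₁≈0 = trans (sym (const+const-*H-∫-apply-0 c₁ c₂ P)) (u≈0 0)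
      c₂P₀≈0 : c₂ * P 0 ≈ 0#
      c₂P₀≈0 = trans (sym (const+const-*H-∫-apply-1 c₁ c₂ P)) (u≈0 1)
      P₀≈z₀z₀ : P 0 ≈ z 0 * z 0
      P₀≈z₀z₀ = trans (*H-apply-0 E (z *H z)) (trans (*-identityˡ _) (*H-apply-0 z z))
      c₂≈0 : c₂ ≈ 0#
      c₂≈0 = cancel-unitʳ y₁₀z₀≈1 (cancel-unitʳ y₁₀z₀≈1
               (trans (*-assoc c₂ (z 0) (z 0)) (trans (*-congˡ (sym P₀≈z₀z₀)) c₂P₀≈0)))
        where
        y₁₀z₀≈1 : y₁ 0 * z 0 ≈ 1#
        y₁₀z₀≈1 = trans (sym (*H-apply-0 y₁ z)) (y₁z≈1 0)

theorem4p8 : ∀ {c ℓ : Level} (R : CommutativeRing c ℓ) → IsField R →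
    let open CommutativeRing R
        open Hurwitz R
    in (h₀ h₁ y₁ y₁⁻¹ : HA) →
       y₁ *H y₁⁻¹ ≈H 1H →
       L h₀ h₁ y₁ ≈H 0H →
       let w  = ∫ (exp (-H (∫ h₁)) *H (y₁⁻¹ *H y₁⁻¹))
           y₂ = y₁ *H w
       in ((c₁ c₂ : Carrier) → const c₁ *H y₁ +H const c₂ *H y₂ ≈H 0H → (c₁ ≈ 0#) × (c₂ ≈ 0#))
          × ((y : HA) → (L h₀ h₁ y ≈H 0H) ⇔ (∃₂ λ c₁ c₂ → y ≈H y₁ *H (const c₁ +H const c₂ *H w)))
theorem4p8 R _ h₀ h₁ y₁ y₁⁻¹ y₁y₁⁻¹≈1 Ly₁≈0 =
  independent , λ y → mk⇔ (solution⇒y₁[c₁+c₂w] y)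
                           (λ (c₁ , c₂ , y≈) → HA.trans (L-cong y≈) (y₁[c₁+c₂w]-solves c₁ c₂))
  where
  open SecondOrder R h₀ h₁
  open SolutionSpace y₁ y₁⁻¹ y₁y₁⁻¹≈1 Ly₁≈0
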